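{- Over intuitionistic propositional logic $\mathbf{IPL}$, the following three axiom schemas are equivalent, i.e. adding any one of them (with all substitution instances) to a Hilbert system for $\mathbf{IPL}$ with modus ponens yields a system deriving all instances of the other two: 1. $\boldsymbol{su} = ((\neg p\to q)\land(\neg q\to p) \rightarrow r \vee s) \to ( p \rightarrow r) \vee(q \rightarrow s)$; 2. $\boldsymbol{aa^+} = ((p\to q) \rightarrow r \vee s) \to (( p\to q) \rightarrow r) \vee(\neg p \rightarrow s)$; 3. $\boldsymbol{aa} = ((\neg p\to q) \rightarrow r \vee s) \to ((\neg p\to q) \rightarrow r) \vee(\neg\neg p \rightarrow s)$.
   Context: Formulas are built from propositional variables and $\bot$ with $\land,\lor,\to$; $\neg\alpha$ abbreviates $\alpha\to\bot$. -}

module Defs where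

open import Data.Nat using (ℕ)
open import Data.Product using (Σ; _×_)
open import Relation.Binary.PropositionalEquality using (_≡_)

infixr 5 _⇒_
infixl 7 _∧_
infixl 6 _∨_

data Fm : Set where
  var : ℕ → Fm
  ⊥′  : Fm
  _∧_ : Fm → Fm → Fm
  _∨_ : Fm → Fm → Fm
  _⇒_ : Fm → Fm → Fm

~_ : Fm → Fm
~ a = a ⇒ ⊥′

infix 8 ~_

sub : (ℕ → Fm) → Fm → Fm
sub σ (var n) = σ n
sub σ ⊥′ = ⊥′
sub σ (a ∧ b) = sub σ a ∧ sub σ b
sub σ (a ∨ b) = sub σ a ∨ sub σ b
sub σ (a ⇒ b) = sub σ a ⇒ sub σ b

data _⊢_ (χ : Fm) : Fm → Set where
  ax-K   : ∀ a b → χ ⊢ (a ⇒ b ⇒ a)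
  ax-S   : ∀ a b c → χ ⊢ ((a ⇒ b ⇒ c) ⇒ (a ⇒ b) ⇒ a ⇒ c)
  ax-∧I  : ∀ a b → χ ⊢ (a ⇒ b ⇒ a ∧ b)
  ax-∧E₁ : ∀ a b → χ ⊢ (a ∧ b ⇒ a)
  ax-∧E₂ : ∀ a b → χ ⊢ (a ∧ b ⇒ b)
  ax-∨I₁ : ∀ a b → χ ⊢ (a ⇒ a ∨ b)
  ax-∨I₂ : ∀ a b → χ ⊢ (b ⇒ a ∨ b)
  ax-∨E  : ∀ a b c → χ ⊢ ((a ⇒ c) ⇒ (b ⇒ c) ⇒ a ∨ b ⇒ c)
  ax-⊥   : ∀ a → χ ⊢ (⊥′ ⇒ a)
  ax-χ   : (σ : ℕ → Fm) → χ ⊢ sub σ χ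
  mp     : ∀ {a b} → χ ⊢ (a ⇒ b) → χ ⊢ a → χ ⊢ b

infix 4 _⊢_

Derives : Fm → Fm → Set
Derives χ ψ = (σ : ℕ → Fm) → χ ⊢ sub σ ψ

Equiv : Fm → Fm → Set
Equiv χ ψ = Derives χ ψ × Derives ψ χ

p q r s : Fm
p = var 0
q = var 1
r = var 2
s = var 3

su : Fm
su = ((~ p ⇒ q) ∧ (~ q ⇒ p) ⇒ r ∨ s) ⇒ (p ⇒ r) ∨ (q ⇒ s)

aa⁺ : Fm
aa⁺ = ((p ⇒ q) ⇒ r ∨ s) ⇒ ((p ⇒ q) ⇒ r) ∨ (~ p ⇒ s)

aa : Fm
aa = ((~ p ⇒ q) ⇒ r ∨ s) ⇒ ((~ p ⇒ q) ⇒ r) ∨ (~ ~ p ⇒ s)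

{-# OPTIONS --safe #-}
-- The schemas are derived in the cycle su → aa⁺ → aa → su.  aa is literally the
-- instance of aa⁺ at p := ¬p.  Instantiating su at p := P → Q, q := ¬P turns the
-- premise of aa⁺ into that of su, because the conjunct ¬¬P → (P → Q) alone
-- already yields P → Q.  Conversely, two nested instances of aa discharge the
-- conjuncts ¬P → Q and ¬Q → P of the premise of su one at a time; the price is a
-- double negation ¬¬P (resp. ¬¬Q) in the conclusion, which is harmless once P
-- (resp. Q) is assumed.
module Submission where

open import Defs
open import Data.Product using (_×_; _,_)
open import Data.Nat using (ℕ)
open import Data.List using (List; []; _∷_)
open import Data.List.Membership.Propositional using (_∈_)
open import Data.List.Relation.Unary.Any using (here; there)
open import Relation.Binary.PropositionalEquality using (_≡_; refl; cong₂; subst; sym)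

sub-sub : ∀ σ τ a → sub σ (sub τ a) ≡ sub (λ n → sub σ (τ n)) a
sub-sub σ τ (var n) = refl
sub-sub σ τ ⊥′      = refl
sub-sub σ τ (a ∧ b) = cong₂ _∧_ (sub-sub σ τ a) (sub-sub σ τ b)
sub-sub σ τ (a ∨ b) = cong₂ _∨_ (sub-sub σ τ a) (sub-sub σ τ b)
sub-sub σ τ (a ⇒ b) = cong₂ _⇒_ (sub-sub σ τ a) (sub-sub σ τ b)

Derives-instance : ∀ {χ} τ → Derives χ (sub τ χ)
Derives-instance {χ} τ σ = subst (χ ⊢_) (sym (sub-sub σ τ χ)) (ax-χ (λ n → sub σ (τ n)))

⊢-replace : ∀ {χ ψ a} → Derives χ ψ → ψ ⊢ a → χ ⊢ a
⊢-replace D (ax-K a b)     = ax-K a b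
⊢-replace D (ax-S a b c)   = ax-S a b c
⊢-replace D (ax-∧I a b)    = ax-∧I a b
⊢-replace D (ax-∧E₁ a b)   = ax-∧E₁ a b
⊢-replace D (ax-∧E₂ a b)   = ax-∧E₂ a b
⊢-replace D (ax-∨I₁ a b)   = ax-∨I₁ a b
⊢-replace D (ax-∨I₂ a b)   = ax-∨I₂ a b
⊢-replace D (ax-∨E a b c)  = ax-∨E a b c
⊢-replace D (ax-⊥ a)       = ax-⊥ a
⊢-replace D (ax-χ σ)       = D σ
⊢-replace D (mp f x)       = mp (⊢-replace D f) (⊢-replace D x)

Derives-trans : ∀ {χ ψ θ} → Derives χ ψ → Derives ψ θ → Derives χ θ
Derives-trans D E σ = ⊢-replace D (E σ)

Equiv-cycle : ∀ {χ ψ θ} → Derives χ ψ → Derives ψ θ → Derives θ χ →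
              Equiv χ ψ × Equiv ψ θ × Equiv χ θ
-- Derives χ ψ unfolds to a Π-type over sub σ ψ, from which ψ cannot be inferred.
Equiv-cycle {χ} {ψ} {θ} χψ ψθ θχ =
    (χψ , Derives-trans {ψ} {θ} {χ} ψθ θχ)
  , (ψθ , Derives-trans {θ} {χ} {ψ} θχ χψ)
  , (Derives-trans {χ} {ψ} {θ} χψ ψθ , θχ)

infix  4 _∣_⊢_
infixl 9 _·_

data _∣_⊢_ (χ : Fm) (Γ : List Fm) : Fm → Set where
  axiom : ∀ {a} → χ ⊢ a → χ ∣ Γ ⊢ a
  hyp   : ∀ {a} → a ∈ Γ → χ ∣ Γ ⊢ a
  _·_   : ∀ {a b} → χ ∣ Γ ⊢ a ⇒ b → χ ∣ Γ ⊢ a → χ ∣ Γ ⊢ b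

module _ {χ : Fm} where

  infixr 5 ƛ_

  ⊢-refl : ∀ a → χ ⊢ a ⇒ a
  ⊢-refl a = mp (mp (ax-S a (a ⇒ a) a) (ax-K a (a ⇒ a))) (ax-K a a)

  ƛ_ : ∀ {Γ a b} → χ ∣ a ∷ Γ ⊢ b → χ ∣ Γ ⊢ a ⇒ b
  ƛ axiom d              = axiom (mp (ax-K _ _) d)
  ƛ hyp (here refl)      = axiom (⊢-refl _)
  ƛ hyp (there i)        = axiom (ax-K _ _) · hyp i
  ƛ (f · x)              = axiom (ax-S _ _ _) · (ƛ f) · (ƛ x)

  closed : ∀ {a} → χ ∣ [] ⊢ a → χ ⊢ a
  closed (axiom d) = d
  closed (f · x)   = mp (closed f) (closed x)

  #0 : ∀ {Γ a} → χ ∣ a ∷ Γ ⊢ a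
  #0 = hyp (here refl)

  #1 : ∀ {Γ a b} → χ ∣ b ∷ a ∷ Γ ⊢ a
  #1 = hyp (there (here refl))

  #2 : ∀ {Γ a b c} → χ ∣ c ∷ b ∷ a ∷ Γ ⊢ a
  #2 = hyp (there (there (here refl)))

  χ-instance : ∀ {Γ} σ → χ ∣ Γ ⊢ sub σ χ
  χ-instance σ = axiom (ax-χ σ)

  pair : ∀ {Γ a b} → χ ∣ Γ ⊢ a → χ ∣ Γ ⊢ b → χ ∣ Γ ⊢ a ∧ b
  pair x y = axiom (ax-∧I _ _) · x · y

  snd : ∀ {Γ a b} → χ ∣ Γ ⊢ a ∧ b → χ ∣ Γ ⊢ b
  snd x = axiom (ax-∧E₂ _ _) · x

  inl : ∀ {Γ a b} → χ ∣ Γ ⊢ a → χ ∣ Γ ⊢ a ∨ b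
  inl x = axiom (ax-∨I₁ _ _) · x

  inr : ∀ {Γ a b} → χ ∣ Γ ⊢ b → χ ∣ Γ ⊢ a ∨ b
  inr x = axiom (ax-∨I₂ _ _) · x

  case : ∀ {Γ a b c} → χ ∣ Γ ⊢ a ∨ b → χ ∣ a ∷ Γ ⊢ c → χ ∣ b ∷ Γ ⊢ c → χ ∣ Γ ⊢ c
  case d l r = axiom (ax-∨E _ _ _) · (ƛ l) · (ƛ r) · d

  ∨-swap : ∀ {Γ a b} → χ ∣ Γ ⊢ a ∨ b → χ ∣ Γ ⊢ b ∨ a
  ∨-swap d = case d (inr #0) (inl #0)

[_,_,_,_] : Fm → Fm → Fm → Fm → ℕ → Fm
[ a , b , c , d ] 0 = a
[ a , b , c , d ] 1 = b
[ a , b , c , d ] 2 = c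
[ a , b , c , d ] 3 = d
[ a , b , c , d ] _ = ⊥′

su⇒aa⁺ : Derives su aa⁺
su⇒aa⁺ σ = closed (ƛ χ-instance [ P ⇒ Q , ~ P , R , S ] · (ƛ #1 · (ƛ snd #1 · (ƛ #0 · #1) · #0)))
  where
  P Q R S : Fm
  P = σ 0
  Q = σ 1
  R = σ 2
  S = σ 3

aa⁺⇒aa : Derives aa⁺ aa
aa⁺⇒aa = Derives-instance [ ~ p , q , r , s ]

aa⇒su : Derives aa su
aa⇒su σ = closed (ƛ case split
    (inl (ƛ #1 · (ƛ #1) · (ƛ #0 · #1)))
    (inr (ƛ #1 · (ƛ #0 · #1) · (ƛ #1))))
  where
  P Q R S : Fm
  P = σ 0
  Q = σ 1
  R = σ 2
  S = σ 3
  split : aa ∣ _ ∷ [] ⊢ ((~ Q ⇒ P) ⇒ ~ ~ P ⇒ R) ∨ (~ ~ Q ⇒ (~ P ⇒ Q) ⇒ S)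
  split = χ-instance [ Q , P , ~ ~ P ⇒ R , (~ P ⇒ Q) ⇒ S ]
    · (ƛ ∨-swap (χ-instance [ P , Q , S , R ] · (ƛ ∨-swap (#2 · pair #0 #1))))

lemma1 : Equiv su aa⁺ × Equiv aa⁺ aa × Equiv su aa
lemma1 = Equiv-cycle su⇒aa⁺ aa⁺⇒aa aa⇒su
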